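{- If $G$ is a non-empty (i.e. having at least one edge) finite simple graph with order $n$ and maximum degree $\Delta$, and $k$ is a positive integer, then $\mathrm{mof}_k(G) \leq \max \{n - k, n - \Delta \}$.
   Context: An orientation $D$ of a simple graph $G$ assigns to each edge exactly one direction; if $(u,v)$ is an arc, $v$ is an out-neighbor of $u$. Oriented $k$-forcing: starting from a nonempty set $S$ of colored vertices, repeatedly, any colored vertex having at most $k$ non-colored out-neighbors forces all of them to become colored (all forcings in a step simultaneous), until no change occurs; $S$ is a $k$-forcing set if all vertices end up colored. $F_k(D)$ is the minimum size of a $k$-forcing set of $D$, and $\mathrm{mof}_k(G)$ is the minimum of $F_k(D)$ over all orientations $D$ of $G$. -}

module Defs where

open import Data.Bool using (Bool; true; false; _∧_; _∨_; not)
open import Data.Nat using (ℕ; zero; suc; _≤ᵇ_; _≤_; _⊔_; _∸_)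
open import Data.Fin using (Fin)
open import Data.Fin.Subset using (Subset; ∣_∣; ⊤; Nonempty)
open import Data.Vec using (tabulate; lookup)
open import Data.List using (allFin)
open import Data.Bool.ListAction using (any)
open import Data.Product using (Σ; ∃; _×_; _,_)
open import Relation.Binary.PropositionalEquality using (_≡_)

record SimpleGraph (n : ℕ) : Set where
  field
    adj     : Fin n → Fin n → Bool
    sym     : ∀ u v → adj u v ≡ adj v u
    irrefl  : ∀ v → adj v v ≡ false

open SimpleGraph public

HasEdge : ∀ {n} → SimpleGraph n → Set
HasEdge {n} G = Σ (Fin n) λ u → Σ (Fin n) λ v → adj G u v ≡ true

degree : ∀ {n} → SimpleGraph n → Fin n → ℕ
degree G v = ∣ tabulate (adj G v) ∣

IsMaxDegree : ∀ {n} → SimpleGraph n → ℕ → Set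
IsMaxDegree {n} G Δ = (∀ v → degree G v ≤ Δ) × (Σ (Fin n) λ v → degree G v ≡ Δ)

record Orientation {n : ℕ} (G : SimpleGraph n) : Set where
  field
    arc       : Fin n → Fin n → Bool
    arc⇒adj   : ∀ u v → arc u v ≡ true → adj G u v ≡ true
    oneDir    : ∀ u v → adj G u v ≡ true → arc u v ≡ true → arc v u ≡ false
    someDir   : ∀ u v → adj G u v ≡ true → (arc u v ∨ arc v u) ≡ true

open Orientation public

uncoloredOut : ∀ {n} {G : SimpleGraph n} → Orientation G → Subset n → Fin n → ℕ
uncoloredOut D S u = ∣ tabulate (λ w → arc D u w ∧ not (lookup S w)) ∣

forceStep : ∀ {n} {G : SimpleGraph n} → ℕ → Orientation G → Subset n → Subset n
forceStep {n} k D S = tabulate λ v →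
  lookup S v ∨ any (λ u → lookup S u ∧ arc D u v ∧ (uncoloredOut D S u ≤ᵇ k)) (allFin n)

iter : ∀ {A : Set} → (A → A) → ℕ → A → A
iter f zero    a = a
iter f (suc t) a = f (iter f t a)

IsForcingSet : ∀ {n} {G : SimpleGraph n} → ℕ → Orientation G → Subset n → Set
IsForcingSet k D S = Nonempty S × ∃ λ t → iter (forceStep k D) t S ≡ ⊤

Fk≤ : ∀ {n} {G : SimpleGraph n} → ℕ → Orientation G → ℕ → Set
Fk≤ {n} k D m = Σ (Subset n) λ S → IsForcingSet k D S × ∣ S ∣ ≤ m

mof≤ : ∀ {n} → ℕ → SimpleGraph n → ℕ → Set
mof≤ k G m = Σ (Orientation G) λ D → Fk≤ k D m

-- Direct every edge away from a vertex v of maximum degree, and the remaining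
-- edges along a ranking of the vertices in which v comes first. Leave a set U
-- of min(k, Δ) neighbours of v uncoloured and colour everything else. Then v
-- is coloured and its uncoloured out-neighbours are exactly the at most k
-- vertices of U, so v forces all of them in a single step.
module Submission where

open import Defs
open import Data.Bool using (Bool; true; false; _∧_; _∨_; not; if_then_else_)
open import Data.Bool.Properties
  using (T-≡; T-∧; ∧-zeroʳ; ∧-identityʳ; ∨-zeroʳ; not-involutive)
open import Data.Bool.ListAction using (any)
open import Data.Fin using (Fin; toℕ; _≟_)
open import Data.Fin.Properties using (toℕ-injective)
open import Data.Fin.Subset using (Subset; ∣_∣; ⊤; ⊥; ∁; _⊆_; _∈_; _∉_; outside; inside)
open import Data.Fin.Subset.Properties
  using (_∈?_; ∣∁p∣≡n∸∣p∣; x∉p⇒x∈∁p; ⊥⊆; ∣⊥∣≡0; out⊆; in⊆in)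
import Data.List as List
open import Data.List.Membership.Propositional using (lose)
open import Data.List.Membership.Propositional.Properties using (∈-allFin)
open import Data.List.Relation.Unary.Any.Properties using (any⁺)
open import Data.Nat using (ℕ; zero; suc; _≤_; _<_; _⊓_; _⊔_; _<?_; _≤ᵇ_; _∸_; z≤n; s≤s)
open import Data.Nat.Properties
  using (<ᵇ⇒<; <-cmp; <-asym; suc-injective; ≤⇒≤ᵇ; ≤-reflexive; m⊓n≤m; m⊓n≤n; ∸-distribˡ-⊓-⊔)
open import Data.Product using (∃; _×_; _,_; proj₁; proj₂)
open import Data.Vec using ([]; _∷_; tabulate; lookup; map; allFin)
open import Data.Vec.Properties
  using ( lookup∘tabulate; tabulate∘lookup; tabulate-cong; tabulate-allFin
        ; map-const; lookup-map; lookup⇒[]=; []=⇒lookup)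
open import Function using (const; _∘′_; Injective)
open import Function.Bundles using (Equivalence)
open import Relation.Binary using (tri<; tri≈; tri>)
open import Relation.Binary.PropositionalEquality
  using (_≡_; _≢_; refl; trans; cong; subst; module ≡-Reasoning)
import Relation.Binary.PropositionalEquality as ≡
open import Relation.Nullary using (yes; no; does; contradiction)
open import Relation.Nullary.Decidable using (dec-true; dec-false)

∈-tabulate⁺ : ∀ {n} {f : Fin n → Bool} {x} → f x ≡ true → x ∈ tabulate f
∈-tabulate⁺ {f = f} {x} fx = lookup⇒[]= x _ (trans (lookup∘tabulate f x) fx)

∈-tabulate⁻ : ∀ {n} {f : Fin n → Bool} {x} → x ∈ tabulate f → f x ≡ true
∈-tabulate⁻ {f = f} {x} x∈ = trans (≡.sym (lookup∘tabulate f x)) ([]=⇒lookup x∈)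

subsetOfSize : ∀ {n} (p : Subset n) {m} → m ≤ ∣ p ∣ → ∃ λ q → q ⊆ p × ∣ q ∣ ≡ m
subsetOfSize []            {zero}  _ = [] , (λ ()) , refl
subsetOfSize (outside ∷ p)         m≤∣p∣ with subsetOfSize p m≤∣p∣
... | q , q⊆p , ∣q∣≡m = outside ∷ q , out⊆ q⊆p , ∣q∣≡m
subsetOfSize {suc n} (inside ∷ p) {zero} _ = ⊥ , ⊥⊆ , ∣⊥∣≡0 (suc n)
subsetOfSize (inside ∷ p) {suc m} (s≤s m≤∣p∣) with subsetOfSize p m≤∣p∣
... | q , q⊆p , ∣q∣≡m = inside ∷ q , in⊆in q⊆p , cong suc ∣q∣≡m

neighbours : ∀ {n} → SimpleGraph n → Fin n → Subset n
neighbours G v = tabulate (adj G v)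

outNeighbours : ∀ {n} {G : SimpleGraph n} → Orientation G → Fin n → Subset n
outNeighbours D u = tabulate (arc D u)

module _ {n} (G : SimpleGraph n) (rank : Fin n → ℕ) (rank-injective : Injective _≡_ _≡_ rank) where

  private
    upward : Fin n → Fin n → Bool
    upward u w = adj G u w ∧ does (rank u <? rank w)

    upward⁻ : ∀ {u w} → upward u w ≡ true → adj G u w ≡ true × rank u < rank w
    upward⁻ {u} {w} uw with Equivalence.to T-∧ (Equivalence.from T-≡ uw)
    ... | adj-uw , u<w = Equivalence.to T-≡ adj-uw , <ᵇ⇒< (rank u) (rank w) u<w

    upward-oneDir : ∀ u w → adj G u w ≡ true → upward u w ≡ true → upward w u ≡ false
    upward-oneDir u w _ uw =
      trans (cong (adj G w u ∧_) (dec-false (rank w <? rank u) (<-asym (proj₂ (upward⁻ uw))))) (∧-zeroʳ _)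

    upward-someDir : ∀ u w → adj G u w ≡ true → (upward u w ∨ upward w u) ≡ true
    upward-someDir u w adj-uw with <-cmp (rank u) (rank w)
    ... | tri< u<w _ _ rewrite adj-uw | dec-true (rank u <? rank w) u<w = refl
    ... | tri> _ _ w<u rewrite trans (SimpleGraph.sym G w u) adj-uw | dec-true (rank w <? rank u) w<u
      = ∨-zeroʳ _
    ... | tri≈ _ u≈w _ with rank-injective u≈w
    ...   | refl = contradiction (trans (≡.sym adj-uw) (irrefl G u)) λ ()

  orientByRank : Orientation G
  orientByRank = record
    { arc     = upward
    ; arc⇒adj = λ _ _ uw → proj₁ (upward⁻ uw)
    ; oneDir  = upward-oneDir
    ; someDir = upward-someDir
    }

  orientByRank-arc : ∀ {u w} → adj G u w ≡ true → rank u < rank w → arc orientByRank u w ≡ true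
  orientByRank-arc {u} {w} adj-uw u<w rewrite adj-uw = dec-true (rank u <? rank w) u<w

rankFirst : ∀ {n} → Fin n → Fin n → ℕ
rankFirst v u = if does (u ≟ v) then 0 else suc (toℕ u)

rankFirst-injective : ∀ {n} (v : Fin n) → Injective _≡_ _≡_ (rankFirst v)
rankFirst-injective v {u} {w} eq with u ≟ v | w ≟ v
... | yes u≡v | yes w≡v = trans u≡v (≡.sym w≡v)
... | no  _   | no  _   = toℕ-injective (suc-injective eq)
... | yes _   | no  _   = contradiction eq λ ()
... | no  _   | yes _   = contradiction eq λ ()

rankFirst-least : ∀ {n} (v : Fin n) {w} → w ≢ v → rankFirst v v < rankFirst v w
rankFirst-least v {w} w≢v rewrite dec-true (v ≟ v) refl | dec-false (w ≟ v) w≢v = s≤s z≤n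

awayFrom : ∀ {n} (G : SimpleGraph n) → Fin n → Orientation G
awayFrom G v = orientByRank G (rankFirst v) (rankFirst-injective v)

neighbours⊆outNeighbours-awayFrom : ∀ {n} (G : SimpleGraph n) v →
  neighbours G v ⊆ outNeighbours (awayFrom G v) v
neighbours⊆outNeighbours-awayFrom G v {w} w∈N =
  ∈-tabulate⁺ (orientByRank-arc G (rankFirst v) (rankFirst-injective v) adj-vw (rankFirst-least v w≢v))
  where
  adj-vw = ∈-tabulate⁻ w∈N
  w≢v : w ≢ v
  w≢v refl = contradiction (trans (≡.sym adj-vw) (irrefl G v)) λ ()

v∉neighbours : ∀ {n} (G : SimpleGraph n) v → v ∉ neighbours G v
v∉neighbours G v v∈N = contradiction (trans (≡.sym (∈-tabulate⁻ v∈N)) (irrefl G v)) λ ()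

module _ {n} {G : SimpleGraph n} (D : Orientation G) {U : Subset n} {u : Fin n}
         (U⊆N⁺ : U ⊆ outNeighbours D u) where

  uncoloredOut-∁ : uncoloredOut D (∁ U) u ≡ ∣ U ∣
  uncoloredOut-∁ = cong ∣_∣ (trans (tabulate-cong uncolored≡U) (tabulate∘lookup U))
    where
    uncolored≡U : ∀ w → (arc D u w ∧ not (lookup (∁ U) w)) ≡ lookup U w
    uncolored≡U w rewrite lookup-map w not U | not-involutive (lookup U w) with lookup U w in w∈U
    ... | true  = trans (∧-identityʳ _) (∈-tabulate⁻ (U⊆N⁺ (lookup⇒[]= w U w∈U)))
    ... | false = ∧-zeroʳ _

  forceStep-∁≡⊤ : ∀ {k} → u ∉ U → ∣ U ∣ ≤ k → forceStep k D (∁ U) ≡ ⊤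
  forceStep-∁≡⊤ {k} u∉U ∣U∣≤k = begin
    forceStep k D (∁ U)          ≡⟨ tabulate-cong coloured ⟩
    tabulate (const true)        ≡⟨ tabulate-allFin _ ⟩
    map (const true) (allFin n)  ≡⟨ map-const _ true ⟩
    ⊤                            ∎
    where
    open ≡-Reasoning
    forcesTo : Fin n → Fin n → Bool
    forcesTo x w = lookup (∁ U) x ∧ arc D x w ∧ (uncoloredOut D (∁ U) x ≤ᵇ k)

    u-forces : ∀ {w} → w ∈ U → forcesTo u w ≡ true
    u-forces w∈U rewrite []=⇒lookup (x∉p⇒x∈∁p u∉U) | ∈-tabulate⁻ (U⊆N⁺ w∈U) | uncoloredOut-∁ =
      Equivalence.to T-≡ (≤⇒≤ᵇ ∣U∣≤k)
    coloured : ∀ w → (lookup (∁ U) w ∨ any (λ x → forcesTo x w) (List.allFin n)) ≡ true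
    coloured w with w ∈? U
    ... | yes w∈U = trans (cong (lookup (∁ U) w ∨_) forced) (∨-zeroʳ _)
      where
      forced : any (λ x → forcesTo x w) (List.allFin n) ≡ true
      forced = Equivalence.to T-≡ (any⁺ _ (lose (∈-allFin u) (Equivalence.from T-≡ (u-forces w∈U))))
    ... | no  w∉U = cong (_∨ any (λ x → forcesTo x w) (List.allFin n)) ([]=⇒lookup (x∉p⇒x∈∁p w∉U))

  ∁-isForcingSet : ∀ {k} → u ∉ U → ∣ U ∣ ≤ k → IsForcingSet k D (∁ U)
  ∁-isForcingSet u∉U ∣U∣≤k = (u , x∉p⇒x∈∁p u∉U) , 1 , forceStep-∁≡⊤ u∉U ∣U∣≤k

mof≤n∸k⊓degree : ∀ {n} (G : SimpleGraph n) k v → mof≤ k G (n ∸ (k ⊓ degree G v))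
mof≤n∸k⊓degree {n} G k v with subsetOfSize (neighbours G v) (m⊓n≤n k (degree G v))
... | U , U⊆N , ∣U∣≡k⊓d =
  awayFrom G v , ∁ U ,
  ∁-isForcingSet (awayFrom G v) (neighbours⊆outNeighbours-awayFrom G v ∘′ U⊆N)
    (v∉neighbours G v ∘′ U⊆N) (subst (_≤ k) (≡.sym ∣U∣≡k⊓d) (m⊓n≤m k (degree G v))) ,
  ≤-reflexive (trans (∣∁p∣≡n∸∣p∣ U) (cong (n ∸_) ∣U∣≡k⊓d))

proposition3p7 : (n : ℕ) (G : SimpleGraph n) (Δ k : ℕ) →
    HasEdge G → IsMaxDegree G Δ → 1 ≤ k →
    mof≤ k G ((n ∸ k) ⊔ (n ∸ Δ))
proposition3p7 n G Δ k _ (_ , v , degree≡Δ) _ =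
  subst (mof≤ k G) (trans (cong (λ d → n ∸ (k ⊓ d)) degree≡Δ) (∸-distribˡ-⊓-⊔ n k Δ))
    (mof≤n∸k⊓degree G k v)
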